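{- Let $R$ be an integral domain. Then there exists a field $F$ such that $N_{n}(R)=N_{n}(F)$ for all positive integers $n$. Furthermore, if $R$ has characteristic $c$, then $F$ can be chosen to have characteristic $c$ as well.
   Context: For a ring $R$, let $S(R):=\{a^{2} : a\in R\}$ denote the set of squares in $R$. For a subset $A\subseteq R$, the sumset is $A+A:=\{a+b : a,b\in A\}$. For a positive integer $n$, define $N_{n}(R):=\inf\{\,|A+A| : A\subseteq S(R),\ |A|=n\,\}$. An integral domain is a commutative ring in which the product of two nonzero elements is nonzero. -}

module Defs where

open import Level using (_⊔_)
open import Algebra.Bundles using (CommutativeRing)
open import Data.Nat using (ℕ; zero; suc)
open import Data.Nat.Divisibility using (_∣_)
open import Data.Fin using (Fin)
open import Data.Vec using (Vec; lookup)
open import Data.Product using (_×_; ∃; Σ)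
open import Data.Sum using (_⊎_)
open import Relation.Nullary using (¬_)
open import Relation.Binary.PropositionalEquality using (_≢_)

module _ {c ℓ} (R : CommutativeRing c ℓ) where
  open CommutativeRing R

  IsIntegralDomain : Set (c ⊔ ℓ)
  IsIntegralDomain = (¬ (1# ≈ 0#)) × (∀ x y → x * y ≈ 0# → (x ≈ 0#) ⊎ (y ≈ 0#))

  IsField : Set (c ⊔ ℓ)
  IsField = (¬ (1# ≈ 0#)) × (∀ x → ¬ (x ≈ 0#) → ∃ λ y → x * y ≈ 1#)

  IsSquare : Carrier → Set (c ⊔ ℓ)
  IsSquare x = ∃ λ a → a * a ≈ x

  natCast : ℕ → Carrier
  natCast zero    = 0#
  natCast (suc k) = 1# + natCast k

  HasCharacteristic : ℕ → Set ℓ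
  HasCharacteristic k = (natCast k ≈ 0#) × (∀ m → natCast m ≈ 0# → k ∣ m)

  -- a set A of exactly n elements, listed without repetition
  Distinct : ∀ {n} → Vec Carrier n → Set ℓ
  Distinct {n} A = ∀ (i j : Fin n) → i ≢ j → ¬ (lookup A i ≈ lookup A j)

  -- |A + A| ≤ m : the sumset A + A is covered by some m elements
  SumsetAtMost : ∀ {n} → Vec Carrier n → ℕ → Set (c ⊔ ℓ)
  SumsetAtMost {n} A m =
    ∃ λ (B : Vec Carrier m) → ∀ (i j : Fin n) → ∃ λ (k : Fin m) → lookup A i + lookup A j ≈ lookup B k

  -- N_n(R) ≤ m : some A ⊆ S(R) with |A| = n has |A + A| ≤ m
  NAtMost : ℕ → ℕ → Set (c ⊔ ℓ)
  NAtMost n m = ∃ λ (A : Vec Carrier n) →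
    Distinct A × (∀ i → IsSquare (lookup A i)) × SumsetAtMost A m

module Submission where

-- Every integral domain R sits inside its field of fractions F = Frac(R), and
-- F already has the same square-sumset numbers N_n and the same characteristic.
--
-- The argument is organised around "square configurations": roots w₁ … wₙ
-- whose squares are pairwise distinct, together with m elements b₁ … bₘ
-- containing every sum wᵢ² + wⱼ².
-- Configurations
--   * are transported along, and reflected by, injective ring homomorphisms;
--   * survive dilation wᵢ ↦ t·wᵢ, bₖ ↦ t²·bₖ by a cancellable element t.
-- Hence N_n(R) ≤ m implies N_n(F) ≤ m along the embedding ι : R → F.
-- Conversely, a configuration in F has a common denominator D ≠ 0; dilating by
-- t = ι D moves all roots and all bₖ into ι(R), and reflecting along ι gives a
-- configuration in R.  The characteristic is likewise preserved by any injective
-- ring homomorphism.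

open import Defs
open import Level using (_⊔_)
open import Algebra.Bundles using (CommutativeRing)
open import Algebra.Morphism.Structures using (module RingMorphisms)
open import Data.Nat using (ℕ; zero; suc; _≤_)
open import Data.Fin using (Fin; zero; suc)
open import Data.Vec using (Vec; lookup; tabulate)
open import Data.Vec.Properties using (lookup∘tabulate)
open import Data.Product using (_×_; _,_; proj₁; proj₂; ∃; Σ)
open import Data.Sum using (_⊎_; inj₁; inj₂)
open import Data.Empty using (⊥-elim)
open import Function using (_∘_)
open import Function.Bundles using (_⇔_; mk⇔; Equivalence)
open import Relation.Nullary using (¬_)
open import Relation.Binary.PropositionalEquality using (_≢_)

module IntegralDomain {c ℓ} (R : CommutativeRing c ℓ) (dom : IsIntegralDomain R) where
  open CommutativeRing R
  open import Algebra.Properties.Ring ring using (-‿distribˡ-*)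
  open import Algebra.Properties.Group +-group using (x∙y⁻¹≈ε⇒x≈y)
  open import Relation.Binary.Reasoning.Setoid setoid

  1≉0 : ¬ 1# ≈ 0#
  1≉0 = proj₁ dom

  *-nonzero : ∀ {x y} → ¬ x ≈ 0# → ¬ y ≈ 0# → ¬ x * y ≈ 0#
  *-nonzero x≉0 y≉0 xy≈0 with proj₂ dom _ _ xy≈0
  ... | inj₁ x≈0 = x≉0 x≈0
  ... | inj₂ y≈0 = y≉0 y≈0

  *-cancelʳ : ∀ {x y d} → ¬ d ≈ 0# → x * d ≈ y * d → x ≈ y
  *-cancelʳ {x} {y} {d} d≉0 xd≈yd with proj₂ dom (x - y) d difference≈0
    where
    difference≈0 : (x - y) * d ≈ 0#
    difference≈0 = begin
      (x - y) * d         ≈⟨ distribʳ d x (- y) ⟩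
      x * d + (- y) * d   ≈⟨ +-congˡ (-‿distribˡ-* y d) ⟨
      x * d - y * d       ≈⟨ +-congʳ xd≈yd ⟩
      y * d - y * d       ≈⟨ -‿inverseʳ (y * d) ⟩
      0#                  ∎
  ... | inj₁ x-y≈0 = x∙y⁻¹≈ε⇒x≈y x y x-y≈0
  ... | inj₂ d≈0   = ⊥-elim (d≉0 d≈0)

  *-cancelˡ : ∀ {x y d} → ¬ d ≈ 0# → d * x ≈ d * y → x ≈ y
  *-cancelˡ {x} {y} {d} d≉0 dx≈dy =
    *-cancelʳ d≉0 (trans (*-comm x d) (trans dx≈dy (*-comm d y)))

module SquareConfigurations {c ℓ} (R : CommutativeRing c ℓ) where
  open CommutativeRing R
  open import Relation.Binary.Reasoning.Setoid setoid
  open import Algebra.Solver.Ring.NaturalCoefficients.Default commutativeSemiring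

  record SquareConfig {n m} (w : Fin n → Carrier) (b : Fin m → Carrier) : Set ℓ where
    constructor squareConfig
    field
      distinctSquares : ∀ i j → i ≢ j → ¬ w i * w i ≈ w j * w j
      coversSums      : ∀ i j → ∃ λ (k : Fin m) → w i * w i + w j * w j ≈ b k

  NAtMost→SquareConfig : ∀ {n m} → NAtMost R n m →
    ∃ λ w → ∃ λ b → SquareConfig {n} {m} w b
  NAtMost→SquareConfig {n} (A , distinct , square , B , covers) =
    w , lookup B , squareConfig distinctSq coversSq
    where
    w : Fin n → Carrier
    w = proj₁ ∘ square
    w²≈A : ∀ i → w i * w i ≈ lookup A i
    w²≈A = proj₂ ∘ square
    distinctSq : ∀ i j → i ≢ j → ¬ w i * w i ≈ w j * w j
    distinctSq i j i≢j eq = distinct i j i≢j (trans (sym (w²≈A i)) (trans eq (w²≈A j)))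
    coversSq : ∀ i j → ∃ λ k → w i * w i + w j * w j ≈ lookup B k
    coversSq i j with covers i j
    ... | k , sum≈Bk = k , trans (+-cong (w²≈A i) (w²≈A j)) sum≈Bk

  SquareConfig→NAtMost : ∀ {n m} {w : Fin n → Carrier} {b : Fin m → Carrier} →
    SquareConfig w b → NAtMost R n m
  SquareConfig→NAtMost {n} {m} {w} {b} (squareConfig distinctSq coversSq) =
    A , distinct , square , tabulate b , covers
    where
    A : Vec Carrier n
    A = tabulate (λ i → w i * w i)
    A≈w² : ∀ i → lookup A i ≈ w i * w i
    A≈w² i = reflexive (lookup∘tabulate (λ i → w i * w i) i)
    distinct : Distinct R A
    distinct i j i≢j eq = distinctSq i j i≢j (trans (sym (A≈w² i)) (trans eq (A≈w² j)))
    square : ∀ i → IsSquare R (lookup A i)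
    square i = w i , sym (A≈w² i)
    covers : ∀ i j → ∃ λ k → lookup A i + lookup A j ≈ lookup (tabulate b) k
    covers i j with coversSq i j
    ... | k , sum≈bk = k , (begin
      lookup A i + lookup A j   ≈⟨ +-cong (A≈w² i) (A≈w² j) ⟩
      w i * w i + w j * w j     ≈⟨ sum≈bk ⟩
      b k                       ≈⟨ reflexive (lookup∘tabulate b k) ⟨
      lookup (tabulate b) k     ∎)

  SquareConfig-resp : ∀ {n m} {w w' : Fin n → Carrier} {b b' : Fin m → Carrier} →
    (∀ i → w i ≈ w' i) → (∀ k → b k ≈ b' k) → SquareConfig w b → SquareConfig w' b'
  SquareConfig-resp {w = w} {w'} {b' = b'} w≈w' b≈b' (squareConfig distinctSq coversSq) =
    squareConfig distinct' covers'
    where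
    sq≈ : ∀ i → w i * w i ≈ w' i * w' i
    sq≈ i = *-cong (w≈w' i) (w≈w' i)
    distinct' : ∀ i j → i ≢ j → ¬ w' i * w' i ≈ w' j * w' j
    distinct' i j i≢j eq = distinctSq i j i≢j (trans (sq≈ i) (trans eq (sym (sq≈ j))))
    covers' : ∀ i j → ∃ λ k → w' i * w' i + w' j * w' j ≈ b' k
    covers' i j with coversSq i j
    ... | k , sum≈bk = k , trans (sym (+-cong (sq≈ i) (sq≈ j))) (trans sum≈bk (b≈b' k))

  SquareConfig-dilate : ∀ {n m} {w : Fin n → Carrier} {b : Fin m → Carrier} (t : Carrier) →
    (∀ {x y} → t * x ≈ t * y → x ≈ y) →
    SquareConfig w b → SquareConfig (λ i → t * w i) (λ k → (t * t) * b k)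
  SquareConfig-dilate {w = w} {b} t t-cancel (squareConfig distinctSq coversSq) =
    squareConfig distinct' covers'
    where
    dilatedSq : ∀ i → (t * w i) * (t * w i) ≈ (t * t) * (w i * w i)
    dilatedSq i = solve 2 (λ t x → (t :* x) :* (t :* x) := (t :* t) :* (x :* x)) refl t (w i)
    distinct' : ∀ i j → i ≢ j → ¬ (t * w i) * (t * w i) ≈ (t * w j) * (t * w j)
    distinct' i j i≢j eq =
      distinctSq i j i≢j (t-cancel (t-cancel (begin
        t * (t * (w i * w i))   ≈⟨ *-assoc t t _ ⟨
        (t * t) * (w i * w i)   ≈⟨ dilatedSq i ⟨
        (t * w i) * (t * w i)   ≈⟨ eq ⟩
        (t * w j) * (t * w j)   ≈⟨ dilatedSq j ⟩
        (t * t) * (w j * w j)   ≈⟨ *-assoc t t _ ⟩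
        t * (t * (w j * w j))   ∎)))
    covers' : ∀ i j → ∃ λ k → (t * w i) * (t * w i) + (t * w j) * (t * w j) ≈ (t * t) * b k
    covers' i j with coversSq i j
    ... | k , sum≈bk = k , (begin
      (t * w i) * (t * w i) + (t * w j) * (t * w j)   ≈⟨ +-cong (dilatedSq i) (dilatedSq j) ⟩
      (t * t) * (w i * w i) + (t * t) * (w j * w j)   ≈⟨ distribˡ (t * t) _ _ ⟨
      (t * t) * (w i * w i + w j * w j)               ≈⟨ *-congˡ sum≈bk ⟩
      (t * t) * b k                                   ∎)

module RingMonomorphism {c₁ ℓ₁ c₂ ℓ₂} (R : CommutativeRing c₁ ℓ₁) (F : CommutativeRing c₂ ℓ₂)
  {f : CommutativeRing.Carrier R → CommutativeRing.Carrier F}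
  (mono : RingMorphisms.IsRingMonomorphism (CommutativeRing.rawRing R) (CommutativeRing.rawRing F) f)
  where
  private
    module R = CommutativeRing R
    module F = CommutativeRing F
  open RingMorphisms.IsRingMonomorphism mono
  open SquareConfigurations
    using (SquareConfig; squareConfig; NAtMost→SquareConfig; SquareConfig→NAtMost)
  open Equivalence using (to)
  open import Relation.Binary.Reasoning.Setoid F.setoid

  f-sq : ∀ x → f (x R.* x) F.≈ f x F.* f x
  f-sq x = *-homo x x

  SquareConfig-map⇔ : ∀ {n m} (u : Fin n → R.Carrier) (v : Fin m → R.Carrier) →
    SquareConfig R u v ⇔ SquareConfig F (f ∘ u) (f ∘ v)
  SquareConfig-map⇔ u v = mk⇔ forward backward
    where
    f-sumSq : ∀ i j →
      f (u i R.* u i R.+ u j R.* u j) F.≈ f (u i) F.* f (u i) F.+ f (u j) F.* f (u j)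
    f-sumSq i j = F.trans (+-homo _ _) (F.+-cong (f-sq (u i)) (f-sq (u j)))

    forward : SquareConfig R u v → SquareConfig F (f ∘ u) (f ∘ v)
    forward (squareConfig distinctSq coversSq) = squareConfig distinct' covers'
      where
      distinct' : ∀ i j → i ≢ j → ¬ f (u i) F.* f (u i) F.≈ f (u j) F.* f (u j)
      distinct' i j i≢j eq =
        distinctSq i j i≢j (injective (F.trans (f-sq (u i)) (F.trans eq (F.sym (f-sq (u j))))))
      covers' : ∀ i j → ∃ λ k → f (u i) F.* f (u i) F.+ f (u j) F.* f (u j) F.≈ f (v k)
      covers' i j with coversSq i j
      ... | k , sum≈vk = k , F.trans (F.sym (f-sumSq i j)) (⟦⟧-cong sum≈vk)

    backward : SquareConfig F (f ∘ u) (f ∘ v) → SquareConfig R u v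
    backward (squareConfig distinctSq coversSq) = squareConfig distinct' covers'
      where
      distinct' : ∀ i j → i ≢ j → ¬ u i R.* u i R.≈ u j R.* u j
      distinct' i j i≢j eq =
        distinctSq i j i≢j (F.trans (F.sym (f-sq (u i))) (F.trans (⟦⟧-cong eq) (f-sq (u j))))
      covers' : ∀ i j → ∃ λ k → u i R.* u i R.+ u j R.* u j R.≈ v k
      covers' i j with coversSq i j
      ... | k , sum≈fvk = k , injective (F.trans (f-sumSq i j) sum≈fvk)

  NAtMost-map : ∀ {n m} → NAtMost R n m → NAtMost F n m
  NAtMost-map {n} {m} witness =
    let u , v , config = NAtMost→SquareConfig R {n} {m} witness
    in SquareConfig→NAtMost F (to (SquareConfig-map⇔ u v) config)

  natCast-homo : ∀ k → natCast F k F.≈ f (natCast R k)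
  natCast-homo zero    = F.sym 0#-homo
  natCast-homo (suc k) = begin
    F.1# F.+ natCast F k        ≈⟨ F.+-cong (F.sym 1#-homo) (natCast-homo k) ⟩
    f R.1# F.+ f (natCast R k)  ≈⟨ +-homo R.1# (natCast R k) ⟨
    f (R.1# R.+ natCast R k)    ∎

  HasCharacteristic-transfer : ∀ k → HasCharacteristic R k → HasCharacteristic F k
  HasCharacteristic-transfer k (k≈0 , k-divides) =
    F.trans (natCast-homo k) (F.trans (⟦⟧-cong k≈0) 0#-homo) ,
    λ m m≈0 → k-divides m
      (injective (F.trans (F.sym (natCast-homo m)) (F.trans m≈0 (F.sym 0#-homo))))

module FractionField {c ℓ} (R : CommutativeRing c ℓ) (dom : IsIntegralDomain R) where
  open CommutativeRing R hiding (zero)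
  open IntegralDomain R dom
  open import Algebra.Properties.Ring ring using (-‿distribˡ-*)
  open import Relation.Binary.Reasoning.Setoid setoid
  open import Algebra.Solver.Ring.NaturalCoefficients.Default commutativeSemiring

  record Frac : Set (c ⊔ ℓ) where
    constructor _/_[_]
    field
      num   : Carrier
      den   : Carrier
      den≉0 : ¬ den ≈ 0#
  open Frac

  -- equality of fractions by cross-multiplication (a record, so that it is injective)
  infix 4 _≈F_
  record _≈F_ (p q : Frac) : Set ℓ where
    constructor cross
    field cross-eq : num p * den q ≈ num q * den p

  infixl 6 _+F_
  infixl 7 _*F_
  _+F_ _*F_ : Frac → Frac → Frac
  p +F q = (num p * den q + num q * den p) / (den p * den q) [ *-nonzero (den≉0 p) (den≉0 q) ]
  p *F q = (num p * num q) / (den p * den q) [ *-nonzero (den≉0 p) (den≉0 q) ]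

  -F_ : Frac → Frac
  -F p = (- num p) / den p [ den≉0 p ]

  ι : Carrier → Frac
  ι a = a / 1# [ 1≉0 ]

  0F 1F : Frac
  0F = ι 0#
  1F = ι 1#

  -- transitivity cancels the middle denominator, using that R has no zero divisors
  ≈F-trans : ∀ {p q r} → p ≈F q → q ≈F r → p ≈F r
  ≈F-trans {a / b [ _ ]} {c' / d [ d≉0 ]} {e / f [ _ ]} (cross ad≈cb) (cross cf≈ed) =
    cross (*-cancelʳ d≉0 (begin
      (a * f) * d    ≈⟨ solve 3 (λ a f d → (a :* f) :* d := (a :* d) :* f) refl a f d ⟩
      (a * d) * f    ≈⟨ *-congʳ ad≈cb ⟩
      (c' * b) * f   ≈⟨ solve 3 (λ c b f → (c :* b) :* f := (c :* f) :* b) refl c' b f ⟩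
      (c' * f) * b   ≈⟨ *-congʳ cf≈ed ⟩
      (e * d) * b    ≈⟨ solve 3 (λ e d b → (e :* d) :* b := (e :* b) :* d) refl e d b ⟩
      (e * b) * d    ∎))

  +F-cong : ∀ {p p' q q'} → p ≈F p' → q ≈F q' → p +F q ≈F p' +F q'
  +F-cong {a / b [ _ ]} {a' / b' [ _ ]} {c' / d [ _ ]} {c'' / d' [ _ ]} (cross h₁) (cross h₂) =
    cross (begin
      (a * d + c' * b) * (b' * d')                ≈⟨ regroup a b c' d b' d' ⟩
      (a * b') * (d * d') + (c' * d') * (b * b')  ≈⟨ +-cong (*-cong h₁ (*-comm d d'))
                                                             (*-cong h₂ (*-comm b b')) ⟩
      (a' * b) * (d' * d) + (c'' * d) * (b' * b)  ≈⟨ sym (regroup a' b' c'' d' b d) ⟩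
      (a' * d' + c'' * b') * (b * d)              ∎)
    where
    regroup : ∀ a b c d b' d' →
      (a * d + c * b) * (b' * d') ≈ (a * b') * (d * d') + (c * d') * (b * b')
    regroup = solve 6 (λ a b c d b' d' →
      (a :* d :+ c :* b) :* (b' :* d') := (a :* b') :* (d :* d') :+ (c :* d') :* (b :* b')) refl

  *F-cong : ∀ {p p' q q'} → p ≈F p' → q ≈F q' → p *F q ≈F p' *F q'
  *F-cong {a / b [ _ ]} {a' / b' [ _ ]} {c' / d [ _ ]} {c'' / d' [ _ ]} (cross h₁) (cross h₂) =
    cross (begin
      (a * c') * (b' * d')   ≈⟨ interchange a c' b' d' ⟩
      (a * b') * (c' * d')   ≈⟨ *-cong h₁ h₂ ⟩
      (a' * b) * (c'' * d)   ≈⟨ interchange a' b c'' d ⟩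
      (a' * c'') * (b * d)   ∎)
    where
    interchange : ∀ a b c d → (a * b) * (c * d) ≈ (a * c) * (b * d)
    interchange = solve 4 (λ a b c d → (a :* b) :* (c :* d) := (a :* c) :* (b :* d)) refl

  -F-cong : ∀ {p q} → p ≈F q → -F p ≈F -F q
  -F-cong {a / b [ _ ]} {a' / b' [ _ ]} (cross h) = cross (begin
    (- a) * b'   ≈⟨ -‿distribˡ-* a b' ⟨
    - (a * b')   ≈⟨ -‿cong h ⟩
    - (a' * b)   ≈⟨ -‿distribˡ-* a' b ⟩
    (- a') * b   ∎)

  +F-assoc : ∀ p q r → (p +F q) +F r ≈F p +F (q +F r)
  +F-assoc (a / b [ _ ]) (c' / d [ _ ]) (e / f [ _ ]) = cross
    (solve 6 (λ a b c d e f →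
        ((a :* d :+ c :* b) :* f :+ e :* (b :* d)) :* (b :* (d :* f)) :=
        (a :* (d :* f) :+ (c :* f :+ e :* d) :* b) :* ((b :* d) :* f))
      refl a b c' d e f)

  +F-comm : ∀ p q → p +F q ≈F q +F p
  +F-comm (a / b [ _ ]) (c' / d [ _ ]) = cross
    (solve 4 (λ a b c d → (a :* d :+ c :* b) :* (d :* b) := (c :* b :+ a :* d) :* (b :* d))
      refl a b c' d)

  +F-identityˡ : ∀ p → 0F +F p ≈F p
  +F-identityˡ (a / b [ _ ]) =
    cross (solve 2 (λ a b → (con 0 :* b :+ a :* con 1) :* b := a :* (con 1 :* b)) refl a b)

  +F-identityʳ : ∀ p → p +F 0F ≈F p
  +F-identityʳ p = ≈F-trans (+F-comm p 0F) (+F-identityˡ p)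

  -F-inverseˡ : ∀ p → (-F p) +F p ≈F 0F
  -F-inverseˡ (a / b [ _ ]) = cross (begin
    ((- a) * b + a * b) * 1#   ≈⟨ *-identityʳ _ ⟩
    (- a) * b + a * b          ≈⟨ distribʳ b (- a) a ⟨
    (- a + a) * b              ≈⟨ *-congʳ (-‿inverseˡ a) ⟩
    0# * b                     ≈⟨ zeroˡ b ⟩
    0#                         ≈⟨ zeroˡ (b * b) ⟨
    0# * (b * b)               ∎)

  -F-inverseʳ : ∀ p → p +F (-F p) ≈F 0F
  -F-inverseʳ p = ≈F-trans (+F-comm p (-F p)) (-F-inverseˡ p)

  *F-assoc : ∀ p q r → (p *F q) *F r ≈F p *F (q *F r)
  *F-assoc (a / b [ _ ]) (c' / d [ _ ]) (e / f [ _ ]) = cross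
    (solve 6 (λ a b c d e f →
        ((a :* c) :* e) :* (b :* (d :* f)) := (a :* (c :* e)) :* ((b :* d) :* f))
      refl a b c' d e f)

  *F-comm : ∀ p q → p *F q ≈F q *F p
  *F-comm (a / b [ _ ]) (c' / d [ _ ]) = cross
    (solve 4 (λ a b c d → (a :* c) :* (d :* b) := (c :* a) :* (b :* d)) refl a b c' d)

  *F-identityˡ : ∀ p → 1F *F p ≈F p
  *F-identityˡ (a / b [ _ ]) =
    cross (solve 2 (λ a b → (con 1 :* a) :* b := a :* (con 1 :* b)) refl a b)

  *F-identityʳ : ∀ p → p *F 1F ≈F p
  *F-identityʳ p = ≈F-trans (*F-comm p 1F) (*F-identityˡ p)

  *F-distribˡ : ∀ p q r → p *F (q +F r) ≈F p *F q +F p *F r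
  *F-distribˡ (a / b [ _ ]) (c' / d [ _ ]) (e / f [ _ ]) = cross
    (solve 6 (λ a b c d e f →
        (a :* (c :* f :+ e :* d)) :* ((b :* d) :* (b :* f)) :=
        ((a :* c) :* (b :* f) :+ (a :* e) :* (b :* d)) :* (b :* (d :* f)))
      refl a b c' d e f)

  *F-distribʳ : ∀ p q r → (q +F r) *F p ≈F q *F p +F r *F p
  *F-distribʳ p q r = ≈F-trans (*F-comm (q +F r) p)
    (≈F-trans (*F-distribˡ p q r) (+F-cong (*F-comm p q) (*F-comm p r)))

  Frac-ring : CommutativeRing (c ⊔ ℓ) ℓ
  Frac-ring = record
    { Carrier = Frac ; _≈_ = _≈F_ ; _+_ = _+F_ ; _*_ = _*F_ ; -_ = -F_ ; 0# = 0F ; 1# = 1F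
    ; isCommutativeRing = record
      { isRing = record
        { +-isAbelianGroup = record
          { isGroup = record
            { isMonoid = record
              { isSemigroup = record
                { isMagma = record
                  { isEquivalence = record
                    { refl = cross refl ; sym = λ (cross h) → cross (sym h) ; trans = ≈F-trans }
                  ; ∙-cong = +F-cong }
                ; assoc = +F-assoc }
              ; identity = +F-identityˡ , +F-identityʳ }
            ; inverse = -F-inverseˡ , -F-inverseʳ
            ; ⁻¹-cong = -F-cong }
          ; comm = +F-comm }
        ; *-cong = *F-cong
        ; *-assoc = *F-assoc
        ; *-identity = *F-identityˡ , *F-identityʳ
        ; distrib = *F-distribˡ , *F-distribʳ }
      ; *-comm = *F-comm } }

  ≈0F⇒num≈0 : ∀ {p} → p ≈F 0F → num p ≈ 0#
  ≈0F⇒num≈0 {a / b [ _ ]} (cross h) = trans (sym (*-identityʳ a)) (trans h (zeroˡ b))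

  num≈0⇒≈0F : ∀ {p} → num p ≈ 0# → p ≈F 0F
  num≈0⇒≈0F {a / b [ _ ]} a≈0 = cross (trans (*-identityʳ a) (trans a≈0 (sym (zeroˡ b))))

  Frac-isField : IsField Frac-ring
  Frac-isField = (λ 1≈0 → 1≉0 (≈0F⇒num≈0 1≈0)) , inverse
    where
    inverse : ∀ p → ¬ p ≈F 0F → ∃ λ q → p *F q ≈F 1F
    inverse p@(a / b [ _ ]) p≉0 = b / a [ (λ a≈0 → p≉0 (num≈0⇒≈0F a≈0)) ] ,
      cross (solve 2 (λ a b → (a :* b) :* con 1 := con 1 :* (b :* a)) refl a b)

  Frac-isIntegralDomain : IsIntegralDomain Frac-ring
  Frac-isIntegralDomain = proj₁ Frac-isField , noZeroDivisors
    where
    noZeroDivisors : ∀ p q → p *F q ≈F 0F → p ≈F 0F ⊎ q ≈F 0F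
    noZeroDivisors p q pq≈0 with proj₂ dom (num p) (num q) (≈0F⇒num≈0 pq≈0)
    ... | inj₁ p≈0 = inj₁ (num≈0⇒≈0F p≈0)
    ... | inj₂ q≈0 = inj₂ (num≈0⇒≈0F q≈0)

  open RingMorphisms (CommutativeRing.rawRing R) (CommutativeRing.rawRing Frac-ring)
    using (IsRingMonomorphism)

  ι-cong : ∀ {a b} → a ≈ b → ι a ≈F ι b
  ι-cong a≈b = cross (*-congʳ a≈b)

  ι-+ : ∀ a b → ι (a + b) ≈F ι a +F ι b
  ι-+ a b = cross
    (solve 2 (λ a b → (a :+ b) :* (con 1 :* con 1) := (a :* con 1 :+ b :* con 1) :* con 1) refl a b)

  ι-* : ∀ a b → ι (a * b) ≈F ι a *F ι b
  ι-* a b = cross (solve 2 (λ a b → (a :* b) :* (con 1 :* con 1) := (a :* b) :* con 1) refl a b)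

  ι-isRingMonomorphism : IsRingMonomorphism ι
  ι-isRingMonomorphism = record
    { isRingHomomorphism = record
      { isSemiringHomomorphism = record
        { isNearSemiringHomomorphism = record
          { +-isMonoidHomomorphism = record
            { isMagmaHomomorphism = record
              { isRelHomomorphism = record { cong = ι-cong }
              ; homo = ι-+ }
            ; ε-homo = cross refl }
          ; *-homo = ι-* }
        ; 1#-homo = cross refl }
      ; -‿homo = λ a → cross refl }
    ; injective = λ (cross h) → trans (sym (*-identityʳ _)) (trans h (*-identityʳ _)) }

  private
    module F = CommutativeRing Frac-ring

  InR : Frac → Set (c ⊔ ℓ)
  InR x = ∃ λ r → x ≈F ι r

  InR-resp : ∀ {x y} → x ≈F y → InR x → InR y
  InR-resp x≈y (r , x≈ιr) = r , F.trans (F.sym x≈y) x≈ιr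

  InR-scale : ∀ e {x} → InR x → InR (ι e *F x)
  InR-scale e (r , x≈ιr) = e * r , F.trans (F.*-congˡ {ι e} x≈ιr) (F.sym (ι-* e r))

  InR-multiple : ∀ e D {x} → InR (ι D *F x) → InR (ι (e * D) *F x)
  InR-multiple e D {x} Dx∈R = InR-resp (F.sym rebracket) (InR-scale e Dx∈R)
    where
    rebracket : ι (e * D) *F x ≈F ι e *F (ι D *F x)
    rebracket = F.trans (F.*-congʳ {x} (ι-* e D)) (F.*-assoc (ι e) (ι D) x)

  den-clears : ∀ p e → ι (den p * e) *F p ≈F ι (num p * e)
  den-clears (a / b [ _ ]) e =
    cross (solve 3 (λ a b e → ((b :* e) :* a) :* con 1 := (a :* e) :* (con 1 :* b)) refl a b e)

  -- finitely many fractions have a common denominator: the product of their denominators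
  commonDenominator : ∀ {k} (x : Fin k → Frac) →
    ∃ λ D → ¬ D ≈ 0# × (∀ i → InR (ι D *F x i))
  commonDenominator {zero}  x = 1# , 1≉0 , λ ()
  commonDenominator {suc k} x with commonDenominator (x ∘ suc)
  ... | D , D≉0 , D-clears =
    den (x zero) * D , *-nonzero (den≉0 (x zero)) D≉0 , clears
    where
    clears : ∀ i → InR (ι (den (x zero) * D) *F x i)
    clears zero    = num (x zero) * D , den-clears (x zero) D
    clears (suc i) = InR-multiple (den (x zero)) D {x (suc i)} (D-clears i)

module ClearingDenominators {c ℓ} (R : CommutativeRing c ℓ) (dom : IsIntegralDomain R) where
  open CommutativeRing R using (Carrier; _*_; *-comm)
  open FractionField R dom
  open SquareConfigurations
    using ( SquareConfig; NAtMost→SquareConfig; SquareConfig→NAtMost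
          ; SquareConfig-resp; SquareConfig-dilate )
  open RingMonomorphism R Frac-ring ι-isRingMonomorphism using (SquareConfig-map⇔)
  open IntegralDomain R dom using (*-nonzero)
  open IntegralDomain Frac-ring Frac-isIntegralDomain using (*-cancelˡ)
  open Equivalence using (from)
  private
    module F = CommutativeRing Frac-ring

  -- dilating by a common denominator turns a configuration in Frac(R)
  -- into the image of a configuration in R
  SquareConfig-clearDenominators : ∀ {n m} {w : Fin n → Frac} {b : Fin m → Frac} →
    SquareConfig Frac-ring w b →
    ∃ λ (u : Fin n → Carrier) → ∃ λ (v : Fin m → Carrier) → SquareConfig R u v
  SquareConfig-clearDenominators {n} {m} {w} {b} config
    with commonDenominator w | commonDenominator b
  ... | D₁ , D₁≉0 , D₁-clears | D₂ , D₂≉0 , D₂-clears =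
    u , v , from (SquareConfig-map⇔ u v) imageConfig
    where
    t : Frac
    t = ι (D₁ * D₂)

    t-cancel : ∀ {x y} → t *F x ≈F t *F y → x ≈F y
    t-cancel = *-cancelˡ {d = t} (λ t≈0 → *-nonzero D₁≉0 D₂≉0 (≈0F⇒num≈0 t≈0))

    tw∈R : ∀ i → InR (t *F w i)
    tw∈R i = InR-resp (F.*-congʳ {w i} (ι-cong (*-comm D₂ D₁)))
                      (InR-multiple D₂ D₁ {w i} (D₁-clears i))

    t²b∈R : ∀ k → InR ((t *F t) *F b k)
    t²b∈R k = InR-resp (F.sym (F.*-assoc t t (b k)))
                       (InR-scale (D₁ * D₂) (InR-multiple D₁ D₂ {b k} (D₂-clears k)))

    u : Fin n → Carrier
    u = proj₁ ∘ tw∈R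
    v : Fin m → Carrier
    v = proj₁ ∘ t²b∈R

    imageConfig : SquareConfig Frac-ring (ι ∘ u) (ι ∘ v)
    imageConfig = SquareConfig-resp Frac-ring (proj₂ ∘ tw∈R) (proj₂ ∘ t²b∈R)
                    (SquareConfig-dilate Frac-ring t t-cancel config)

  NAtMost-clearDenominators : ∀ {n m} → NAtMost Frac-ring n m → NAtMost R n m
  NAtMost-clearDenominators {n} {m} witness =
    let w , b , config = NAtMost→SquareConfig Frac-ring {n} {m} witness
        u , v , config' = SquareConfig-clearDenominators config
    in SquareConfig→NAtMost R config'

mainTheorem1 : ∀ {c ℓ} (R : CommutativeRing c ℓ) → IsIntegralDomain R →
    Σ (CommutativeRing (c ⊔ ℓ) ℓ) λ F → IsField F
    × (∀ (n : ℕ) → 1 ≤ n → ∀ (m : ℕ) → NAtMost R n m ⇔ NAtMost F n m)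
    × (∀ (k : ℕ) → HasCharacteristic R k → HasCharacteristic F k)
mainTheorem1 R dom =
  Frac-ring , Frac-isField ,
  (λ n _ m → mk⇔ NAtMost-map NAtMost-clearDenominators) ,
  HasCharacteristic-transfer
  where
  open FractionField R dom
  open ClearingDenominators R dom
  open RingMonomorphism R Frac-ring ι-isRingMonomorphism
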